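{- Let $m$ be a refinement mapping from a high-level BAT $\mathcal{D}^h$ to a low-level BAT $\mathcal{D}^l$, and suppose $\mathcal{D}^h$ is a sound abstraction of $\mathcal{D}^l$ relative to $m$. Then $\mathcal{D}^h$ is also a complete abstraction of $\mathcal{D}^l$ relative to $m$ if and only if for every model $M_h$ of $\mathcal{D}^h_{S_0}\cup\mathcal{D}^h_{ca}\cup\mathcal{D}^h_{coa}$ there exists a model $M_l$ of $\mathcal{D}^l_{S_0}\cup\mathcal{D}^l_{ca}\cup\mathcal{D}^l_{coa}$ such that $S_0^{M_h}\simeq_m^{M_h,M_l}S_0^{M_l}$.
   Context: Situation calculus setting. Objects are a countably infinite set $\mathcal{N}$ of standard names (unique names and domain closure); no function symbols other than constants; no non-fluent predicates. Situations: $S_0$ and $do(a,s)$; $do([a_1,\dots,a_n],s)$ abbreviates $do(a_n,\dots,do(a_1,s)\dots)$, also written $do(\vec a,s)$. $Poss(a,s)$ means $a$ is executable in $s$. A basic action theory (BAT) over finitely many action types $\mathcal{A}$ and fluents $\mathcal{F}$ is the union of: initial-state axioms $\mathcal{D}_{S_0}$ (first-order, about $S_0$ only); precondition axioms $Poss(A(\vec x),s)\equiv\phi^{Poss}_A(\vec x,s)$; successor state axioms $F(\vec x,do(a,s))\equiv\phi^{ssa}_F(\vec x,a,s)$ (right-hand sides uniform in $s$); $\mathcal{D}_{ca}$, unique names axioms for actions and domain closure on action types; $\mathcal{D}_{coa}$, unique names and domain closure for the object constants in $\mathcal{N}$; and the foundational axioms $\Sigma$. A situation-suppressed formula omits situation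 arguments of fluents; $\phi[s]$ restores $s$. ConGolog programs $\delta::=\alpha\mid\varphi?\mid\delta_1;\delta_2\mid\delta_1|\delta_2\mid\pi x.\delta\mid\delta^*\mid\delta_1\|\delta_2$, $nil=True?$; $\mathcal{C}$ are the axioms: $Trans(\alpha,s,\delta',s')\equiv s'=do(\alpha,s)\land Poss(\alpha,s)\land\delta'=True?$; $Trans(\varphi?,s,\delta',s')\equiv False$; $Trans(\delta_1;\delta_2,s,\delta',s')\equiv\exists\delta_1'(Trans(\delta_1,s,\delta_1',s')\land\delta'=\delta_1';\delta_2)\lor(Final(\delta_1,s)\land Trans(\delta_2,s,\delta',s'))$; $Trans(\delta_1|\delta_2,\cdot)\equiv Trans(\delta_1,\cdot)\lor Trans(\delta_2,\cdot)$; $Trans(\pi x.\delta,s,\delta',s')\equiv\exists x.Trans(\delta,s,\delta',s')$; $Trans(\delta^*,s,\delta',s')\equiv\exists\delta''(Trans(\delta,s,\delta'',s')\land\delta'=\delta'';\delta^*)$; $Trans(\delta_1\|\delta_2,s,\delta',s')\equiv\exists\delta_1'(Trans(\delta_1,s,\delta_1',s')\land\delta'=\delta_1'\|\delta_2)\lor\exists\delta_2'(Trans(\delta_2,s,\delta_2',s')\land\delta'=\delta_1\|\delta_2')$; $Final(\alpha,s)\equiv False$; $Final(\varphi?,s)\equiv\varphi[s]$; $Final(\delta_1;\delta_2,s)\equiv Final(\delta_1,s)\land Final(\delta_2,s)$; $Final(\delta_1|\delta_2,s)\equiv Final(\delta_1,s)\lor Final(\delta_2,s)$; $Final(\pi x.\delta,s)\equiv\exists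 x.Final(\delta,s)$; $Final(\delta^*,s)\equiv True$; $Final(\delta_1\|\delta_2,s)\equiv Final(\delta_1,s)\land Final(\delta_2,s)$. $Do(\delta,s,s')\doteq\exists\delta'.Trans^*(\delta,s,\delta',s')\land Final(\delta',s')$, $Trans^*$ the reflexive transitive closure. $\mathcal{D}^h$ and $\mathcal{D}^l$ have action types $\mathcal{A}^h,\mathcal{A}^l$ and fluents $\mathcal{F}^h,\mathcal{F}^l$, sharing only $\mathcal{N}$. A refinement mapping $m$ maps each $A\in\mathcal{A}^h$ to a situation-determined ConGolog program $m(A(\vec x))$ over $\mathcal{D}^l$ with free variables $\vec x$, and each $F\in\mathcal{F}^h$ to a situation-suppressed low-level formula $m(F(\vec x))$ with free variables $\vec x$; $m(\phi)$ substitutes $m(F(\vec x))$ for fluent atoms. For structures $M_h$ (high-level language) and $M_l$ (low-level language), situations $s_h$ of $M_h$ and $s_l$ of $M_l$ are $m$-isomorphic, $s_h\simeq_m^{M_h,M_l}s_l$, iff for every $F\in\mathcal{F}^h$ and variable assignment $v$, $M_h,v[s/s_h]\models F(\vec x,s)$ iff $M_l,v[s/s_l]\models m(F(\vec x))[s]$. For a model $M_h$ of $\mathcal{D}^h$ and a model $M_l$ of $\mathcal{D}^l\cup\mathcal{C}$, a relation $B$ between situation domains is an $m$-bisimulation if each $\langle s_h,s_l\rangle\in B$ satisfies: (1) $s_h\simeq_m^{M_h,M_l}s_l$; (2) for each $A\in\mathcal{A}^h$ and $v$, if some $s_h'$ has $M_h,v[s/s_h,s'/s_h']\models Poss(A(\vec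 x),s)\land s'=do(A(\vec x),s)$ then some $s_l'$ has $M_l,v[s/s_l,s'/s_l']\models Do(m(A(\vec x)),s,s')$ and $\langle s_h',s_l'\rangle\in B$; (3) conversely, if some $s_l'$ has $M_l,v[s/s_l,s'/s_l']\models Do(m(A(\vec x)),s,s')$ then some $s_h'$ has $M_h,v[s/s_h,s'/s_h']\models Poss(A(\vec x),s)\land s'=do(A(\vec x),s)$ and $\langle s_h',s_l'\rangle\in B$. $M_h\sim_m M_l$ iff some $m$-bisimulation contains $\langle S_0^{M_h},S_0^{M_l}\rangle$. $\mathcal{D}^h$ is a sound abstraction of $\mathcal{D}^l$ relative to $m$ iff for every model $M_l$ of $\mathcal{D}^l\cup\mathcal{C}$ there is a model $M_h$ of $\mathcal{D}^h$ with $M_h\sim_m M_l$; it is a complete abstraction iff for every model $M_h$ of $\mathcal{D}^h$ there is a model $M_l$ of $\mathcal{D}^l\cup\mathcal{C}$ with $M_h\sim_m M_l$. -}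

module Defs where

open import Data.Nat using (ℕ; zero; suc)
open import Data.Fin as Fin using (Fin; zero; suc; punchOut)
open import Data.Vec using (Vec; []; _∷_; lookup; map)
open import Data.Product using (Σ; Σ-syntax; _×_; _,_)
open import Data.Sum using (_⊎_)
open import Data.Unit using (⊤)
open import Data.Empty using (⊥)
open import Relation.Nullary using (¬_; yes; no)
open import Relation.Binary.PropositionalEquality using (_≡_)
open import Relation.Binary.Construct.Closure.ReflexiveTransitive using (Star)
open import Function.Bundles using (_⇔_)
open import Level using (Level)

-- Signatures: finitely many action types and fluents (with arities).
-- Objects are the standard names, represented by ℕ.

record Sig : Set where
  field
    nA    : ℕ
    actAr : Fin nA → ℕ
    nF    : ℕ
    fluAr : Fin nF → ℕ        -- arity of each fluent (excluding situation)
open Sig public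

-- Action domain (fixed by D_ca: unique names + domain closure on action types)
Action : Sig → Set
Action L = Σ[ A ∈ Fin (nA L) ] Vec ℕ (actAr L A)

-- Situation-suppressed first-order formulas, de Bruijn style:
-- n object variables, k action variables.

data ObjTerm (n : ℕ) : Set where
  var  : Fin n → ObjTerm n
  name : ℕ → ObjTerm n

data ActTerm (L : Sig) (n k : ℕ) : Set where
  avar : Fin k → ActTerm L n k
  act  : (A : Fin (nA L)) → Vec (ObjTerm n) (actAr L A) → ActTerm L n k

data Fm (L : Sig) : ℕ → ℕ → Set where
  ⊤F  : ∀ {n k} → Fm L n k
  fl  : ∀ {n k} (F : Fin (nF L)) → Vec (ObjTerm n) (fluAr L F) → Fm L n k
  eqO : ∀ {n k} → ObjTerm n → ObjTerm n → Fm L n k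
  eqA : ∀ {n k} → ActTerm L n k → ActTerm L n k → Fm L n k
  neg : ∀ {n k} → Fm L n k → Fm L n k
  and : ∀ {n k} → Fm L n k → Fm L n k → Fm L n k
  exO : ∀ {n k} → Fm L (suc n) k → Fm L n k
  exA : ∀ {n k} → Fm L n (suc k) → Fm L n k

-- A state: the extension of every fluent at one situation.
State : Sig → Set₁
State L = (F : Fin (nF L)) → Vec ℕ (fluAr L F) → Set

evalO : ∀ {n} → Vec ℕ n → ObjTerm n → ℕ
evalO ρ (var i)  = lookup ρ i
evalO ρ (name c) = c

evalA : ∀ {L n k} → Vec ℕ n → Vec (Action L) k → ActTerm L n k → Action L
evalA ρ α (avar j)  = lookup α j
evalA ρ α (act A ts) = A , map (evalO ρ) ts

⟦_⟧ : ∀ {L n k} → Fm L n k → State L → Vec ℕ n → Vec (Action L) k → Set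
⟦ ⊤F ⟧       σ ρ α = ⊤
⟦ fl F ts ⟧  σ ρ α = σ F (map (evalO ρ) ts)
⟦ eqO t u ⟧  σ ρ α = evalO ρ t ≡ evalO ρ u
⟦ eqA t u ⟧  σ ρ α = evalA ρ α t ≡ evalA ρ α u
⟦ neg φ ⟧    σ ρ α = ¬ (⟦ φ ⟧ σ ρ α)
⟦ and φ ψ ⟧  σ ρ α = ⟦ φ ⟧ σ ρ α × ⟦ ψ ⟧ σ ρ α
⟦ exO φ ⟧    σ ρ α = Σ[ c ∈ ℕ ] ⟦ φ ⟧ σ (c ∷ ρ) α
⟦_⟧ {L} (exA φ) σ ρ α = Σ[ a ∈ Action L ] ⟦ φ ⟧ σ ρ (a ∷ α)

-- Structures of the situation calculus language over signature L.
-- Object domain = standard names ℕ (D_coa), action domain = Action L (D_ca).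

record Structure (L : Sig) : Set₁ where
  field
    Sit   : Set
    S0    : Sit
    doₛ   : Action L → Sit → Sit
    Poss  : Action L → Sit → Set
    _⊏_   : Sit → Sit → Set
    holds : (F : Fin (nF L)) → Vec ℕ (fluAr L F) → Sit → Set
  state : Sit → State L
  state s F xs = holds F xs s
open Structure public

record BAT (L : Sig) : Set₁ where
  field
    InInit : Fm L 0 0 → Set
    poss   : (A : Fin (nA L)) → Fm L (actAr L A) 0
    ssa    : (F : Fin (nF L)) → Fm L (fluAr L F) 1
open BAT public

-- M ⊨ D_S0 ∪ D_ca ∪ D_coa   (D_ca, D_coa are built into Structure)
ModelInit : ∀ {L} → BAT L → Structure L → Set
ModelInit D M = ∀ φ → InInit D φ → ⟦ φ ⟧ (state M (S0 M)) [] []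

-- M ⊨ Σ (foundational axioms, second-order induction in full semantics)
ModelΣ : ∀ {L} → Structure L → Set₁
ModelΣ {L} M =
    (∀ a a′ s s′ → doₛ M a s ≡ doₛ M a′ s′ → (a ≡ a′) × (s ≡ s′))
  × (∀ (P : Sit M → Set) → P (S0 M) → (∀ a s → P s → P (doₛ M a s)) → ∀ s → P s)
  × (∀ s → ¬ (_⊏_ M s (S0 M)))
  × (∀ s a s′ → (_⊏_ M s (doₛ M a s′)) ⇔ ((_⊏_ M s s′) ⊎ (s ≡ s′)))

ModelPoss : ∀ {L} → BAT L → Structure L → Set
ModelPoss {L} D M = ∀ (A : Fin (nA L)) xs s →
  Poss M (A , xs) s ⇔ ⟦ poss D A ⟧ (state M s) xs []

ModelSSA : ∀ {L} → BAT L → Structure L → Set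
ModelSSA {L} D M = ∀ (F : Fin (nF L)) xs a s →
  holds M F xs (doₛ M a s) ⇔ ⟦ ssa D F ⟧ (state M s) xs (a ∷ [])

Model : ∀ {L} → BAT L → Structure L → Set₁
Model D M = ModelInit D M × ModelΣ M × ModelPoss D M × ModelSSA D M

data Prog (L : Sig) (n : ℕ) : Set where
  act  : (A : Fin (nA L)) → Vec (ObjTerm n) (actAr L A) → Prog L n
  test : Fm L n 0 → Prog L n
  _⨾_  : Prog L n → Prog L n → Prog L n
  _∣_  : Prog L n → Prog L n → Prog L n
  pi   : Prog L (suc n) → Prog L n
  star : Prog L n → Prog L n
  _∥_  : Prog L n → Prog L n → Prog L n

nil : ∀ {L n} → Prog L n
nil = test ⊤F

substT : ∀ {n} → Fin (suc n) → ℕ → ObjTerm (suc n) → ObjTerm n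
substT i c (name d) = name d
substT i c (var j) with i Fin.≟ j
... | yes _   = name c
... | no i≢j = var (punchOut i≢j)

substA : ∀ {L n k} → Fin (suc n) → ℕ → ActTerm L (suc n) k → ActTerm L n k
substA i c (avar j)   = avar j
substA i c (act A ts) = act A (map (substT i c) ts)

substF : ∀ {L n k} → Fin (suc n) → ℕ → Fm L (suc n) k → Fm L n k
substF i c ⊤F         = ⊤F
substF i c (fl F ts)  = fl F (map (substT i c) ts)
substF i c (eqO t u)  = eqO (substT i c t) (substT i c u)
substF i c (eqA t u)  = eqA (substA i c t) (substA i c u)
substF i c (neg φ)    = neg (substF i c φ)
substF i c (and φ ψ)  = and (substF i c φ) (substF i c ψ)
substF i c (exO φ)    = exO (substF (suc i) c φ)
substF i c (exA φ)    = exA (substF i c φ)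

substP : ∀ {L n} → Fin (suc n) → ℕ → Prog L (suc n) → Prog L n
substP i c (act A ts) = act A (map (substT i c) ts)
substP i c (test φ)   = test (substF i c φ)
substP i c (p ⨾ q)    = substP i c p ⨾ substP i c q
substP i c (p ∣ q)    = substP i c p ∣ substP i c q
substP i c (pi p)     = pi (substP (suc i) c p)
substP i c (star p)   = star (substP i c p)
substP i c (p ∥ q)    = substP i c p ∥ substP i c q

-- instantiate all free variables (variable i gets lookup xs i)
inst : ∀ {L n} → Prog L n → Vec ℕ n → Prog L 0
inst p []       = p
inst p (x ∷ xs) = inst (substP zero x p) xs

closedO : ObjTerm 0 → ℕ
closedO (name c) = c

-- The ConGolog axioms C, interpreted in a structure M (over the term
-- algebra of programs, where they have a unique solution).

module ConGolog {L : Sig} (M : Structure L) where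

  data Final : Prog L 0 → Sit M → Set where
    fin-test  : ∀ {φ s} → ⟦ φ ⟧ (state M s) [] [] → Final (test φ) s
    fin-seq   : ∀ {p q s} → Final p s → Final q s → Final (p ⨾ q) s
    fin-choiceˡ : ∀ {p q s} → Final p s → Final (p ∣ q) s
    fin-choiceʳ : ∀ {p q s} → Final q s → Final (p ∣ q) s
    fin-pi    : ∀ {p s} (c : ℕ) → Final (substP zero c p) s → Final (pi p) s
    fin-star  : ∀ {p s} → Final (star p) s
    fin-conc  : ∀ {p q s} → Final p s → Final q s → Final (p ∥ q) s

  data Trans : Prog L 0 → Sit M → Prog L 0 → Sit M → Set where
    tr-act  : ∀ {A ts s} →
              Poss M (A , map closedO ts) s →
              Trans (act A ts) s nil (doₛ M (A , map closedO ts) s)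
    tr-seqˡ : ∀ {p q p′ s s′} → Trans p s p′ s′ → Trans (p ⨾ q) s (p′ ⨾ q) s′
    tr-seqʳ : ∀ {p q q′ s s′} → Final p s → Trans q s q′ s′ → Trans (p ⨾ q) s q′ s′
    tr-choiceˡ : ∀ {p q d s s′} → Trans p s d s′ → Trans (p ∣ q) s d s′
    tr-choiceʳ : ∀ {p q d s s′} → Trans q s d s′ → Trans (p ∣ q) s d s′
    tr-pi   : ∀ {p d s s′} (c : ℕ) → Trans (substP zero c p) s d s′ → Trans (pi p) s d s′
    tr-star : ∀ {p p′ s s′} → Trans p s p′ s′ → Trans (star p) s (p′ ⨾ star p) s′
    tr-concˡ : ∀ {p q p′ s s′} → Trans p s p′ s′ → Trans (p ∥ q) s (p′ ∥ q) s′
    tr-concʳ : ∀ {p q q′ s s′} → Trans q s q′ s′ → Trans (p ∥ q) s (p ∥ q′) s′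

  Config : Set
  Config = Prog L 0 × Sit M

  Step : Config → Config → Set
  Step (p , s) (p′ , s′) = Trans p s p′ s′

  Trans* : Prog L 0 → Sit M → Prog L 0 → Sit M → Set
  Trans* p s p′ s′ = Star Step (p , s) (p′ , s′)

  Do : Prog L 0 → Sit M → Sit M → Set
  Do p s s′ = Σ[ p′ ∈ Prog L 0 ] Trans* p s p′ s′ × Final p′ s′

  SitDetermined : Prog L 0 → Sit M → Set
  SitDetermined p s = ∀ s′ p′ p″ → Trans* p s p′ s′ → Trans* p s p″ s′ → p′ ≡ p″

open ConGolog public

record RefMap (H : Sig) {L : Sig} (Dl : BAT L) : Set₁ where
  field
    mAct : (A : Fin (nA H)) → Prog L (actAr H A)
    mFl  : (F : Fin (nF H)) → Fm L (fluAr H F) 0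
    sitDet : ∀ (Ml : Structure L) → Model Dl Ml →
             ∀ (A : Fin (nA H)) xs s → SitDetermined Ml (inst (mAct A) xs) s
open RefMap public

module _ {H L : Sig} {Dl : BAT L} (m : RefMap H Dl)
         (Mh : Structure H) (Ml : Structure L) where

  MIso : Sit Mh → Sit Ml → Set
  MIso sh sl = ∀ (F : Fin (nF H)) xs →
    holds Mh F xs sh ⇔ ⟦ mFl m F ⟧ (state Ml sl) xs []

  IsMBisim : (Sit Mh → Sit Ml → Set) → Set
  IsMBisim B = ∀ sh sl → B sh sl →
      MIso sh sl
    × (∀ (A : Fin (nA H)) xs sh′ →
         Poss Mh (A , xs) sh × sh′ ≡ doₛ Mh (A , xs) sh →
         Σ[ sl′ ∈ Sit Ml ] Do Ml (inst (mAct m A) xs) sl sl′ × B sh′ sl′)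
    × (∀ (A : Fin (nA H)) xs sl′ →
         Do Ml (inst (mAct m A) xs) sl sl′ →
         Σ[ sh′ ∈ Sit Mh ] (Poss Mh (A , xs) sh × sh′ ≡ doₛ Mh (A , xs) sh) × B sh′ sl′)

  MBisimilar : Set₁
  MBisimilar = Σ[ B ∈ (Sit Mh → Sit Ml → Set) ] IsMBisim B × B (S0 Mh) (S0 Ml)

-- Models of D^l ∪ C: C is built into the ConGolog semantics above.
SoundAbstraction : ∀ {H L} (Dh : BAT H) (Dl : BAT L) → RefMap H Dl → Set₁
SoundAbstraction {H} {L} Dh Dl m = ∀ (Ml : Structure L) → Model Dl Ml →
  Σ[ Mh ∈ Structure H ] Model Dh Mh × MBisimilar m Mh Ml

CompleteAbstraction : ∀ {H L} (Dh : BAT H) (Dl : BAT L) → RefMap H Dl → Set₁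
CompleteAbstraction {H} {L} Dh Dl m = ∀ (Mh : Structure H) → Model Dh Mh →
  Σ[ Ml ∈ Structure L ] Model Dl Ml × MBisimilar m Mh Ml

module Submission where

open import Defs
open import Data.Empty using (⊥)
open import Data.List using (List; []; _∷_)
open import Data.Nat using (ℕ)
open import Data.Fin using (Fin)
open import Data.Product using (Σ-syntax; _×_; _,_; proj₁)
open import Data.Sum using (_⊎_)
open import Data.Vec using (Vec) renaming (_∷_ to _∷ᵥ_; [] to []ᵥ)
open import Function using (_∘_)
open import Function.Bundles using (_⇔_; mk⇔; Equivalence)
import Function.Properties.Equivalence as ⇔
open import Relation.Binary.PropositionalEquality using (_≡_; refl)
open Equivalence using (to; from)

-- A model of the situation calculus is pinned down, up to agreement of fluents
-- at corresponding situations, by its initial state: successor state axioms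
-- fix the fluents and precondition axioms fix Poss along every action sequence.
-- Hence if M_h ⊨ D^h has an m-isomorphic initial partner M_l ⊨ D^l_S0, unfold
-- M_l into the tree model of D^l over its initial state; soundness yields some
-- M_h′ ⊨ D^h m-bisimilar to it, and M_h′ agrees with M_h at S0, so the
-- bisimulation composed with "same state" relates M_h to the tree model.
-- Conversely, completeness applied to the tree model of D^h over M_h's initial
-- state gives an m-isomorphic low-level partner at S0.

StateEq : ∀ L → State L → State L → Set
StateEq L σ σ′ = ∀ F xs → σ F xs ⇔ σ′ F xs

syntax StateEq L σ σ′ = σ ≈[ L ] σ′

-- MIso m Mh Ml sh sl is definitionally  state Mh sh ≈[ H ] λ F xs → ⟦ mFl m F ⟧ (state Ml sl) xs [],
-- so ≈-sym and ≈-trans apply to m-isomorphisms as well.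

≈-sym : ∀ {L} {σ σ′ : State L} → σ ≈[ L ] σ′ → σ′ ≈[ L ] σ
≈-sym e F xs = ⇔.sym (e F xs)

≈-trans : ∀ {L} {σ σ′ σ″ : State L} → σ ≈[ L ] σ′ → σ′ ≈[ L ] σ″ → σ ≈[ L ] σ″
≈-trans e e′ F xs = ⇔.trans (e F xs) (e′ F xs)

⟦⟧-resp-≈ : ∀ {L n k} (φ : Fm L n k) {σ σ′ : State L} → σ ≈[ L ] σ′ →
            ∀ ρ α → ⟦ φ ⟧ σ ρ α ⇔ ⟦ φ ⟧ σ′ ρ α
⟦⟧-resp-≈ ⊤F        e ρ α = ⇔.refl
⟦⟧-resp-≈ (fl F ts) e ρ α = e F _
⟦⟧-resp-≈ (eqO t u) e ρ α = ⇔.refl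
⟦⟧-resp-≈ (eqA t u) e ρ α = ⇔.refl
⟦⟧-resp-≈ (neg φ)   e ρ α = mk⇔ (λ ¬p → ¬p ∘ from φ⇔) (λ ¬p → ¬p ∘ to φ⇔)
  where φ⇔ = ⟦⟧-resp-≈ φ e ρ α
⟦⟧-resp-≈ (and φ ψ) e ρ α =
  mk⇔ (λ (p , q) → to φ⇔ p , to ψ⇔ q) (λ (p , q) → from φ⇔ p , from ψ⇔ q)
  where φ⇔ = ⟦⟧-resp-≈ φ e ρ α
        ψ⇔ = ⟦⟧-resp-≈ ψ e ρ α
⟦⟧-resp-≈ (exO φ)   e ρ α =
  mk⇔ (λ (c , p) → c , to (φ⇔ c) p) (λ (c , p) → c , from (φ⇔ c) p)
  where φ⇔ = λ c → ⟦⟧-resp-≈ φ e (c ∷ᵥ ρ) α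
⟦⟧-resp-≈ (exA φ)   e ρ α =
  mk⇔ (λ (a , p) → a , to (φ⇔ a) p) (λ (a , p) → a , from (φ⇔ a) p)
  where φ⇔ = λ a → ⟦⟧-resp-≈ φ e ρ (a ∷ᵥ α)

module _ {L} {D : BAT L} {M M′ : Structure L} where

  Poss-resp-≈ : ModelPoss D M → ModelPoss D M′ →
                ∀ {s s′} → state M s ≈[ L ] state M′ s′ →
                ∀ a → Poss M a s ⇔ Poss M′ a s′
  Poss-resp-≈ ap ap′ e (A , xs) =
    ⇔.trans (ap A xs _) (⇔.trans (⟦⟧-resp-≈ (poss D A) e xs []ᵥ) (⇔.sym (ap′ A xs _)))

  doₛ-resp-≈ : ModelSSA D M → ModelSSA D M′ →
               ∀ {s s′} → state M s ≈[ L ] state M′ s′ →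
               ∀ a → state M (doₛ M a s) ≈[ L ] state M′ (doₛ M′ a s′)
  doₛ-resp-≈ ss ss′ e a F xs =
    ⇔.trans (ss F xs a _) (⇔.trans (⟦⟧-resp-≈ (ssa D F) e xs (a ∷ᵥ []ᵥ)) (⇔.sym (ss′ F xs a _)))

-- Situations are action histories, most recent action first.
module TreeModel {L} (D : BAT L) (σ₀ : State L) where

  holdsAfter : (F : Fin (nF L)) → Vec ℕ (fluAr L F) → List (Action L) → Set
  holdsAfter F xs []      = σ₀ F xs
  holdsAfter F xs (a ∷ s) = ⟦ ssa D F ⟧ (λ F′ ys → holdsAfter F′ ys s) xs (a ∷ᵥ []ᵥ)

  _<ₕ_ : List (Action L) → List (Action L) → Set
  s <ₕ []       = ⊥
  s <ₕ (a ∷ s′) = s <ₕ s′ ⊎ s ≡ s′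

  structure : Structure L
  structure = record
    { Sit   = List (Action L)
    ; S0    = []
    ; doₛ   = _∷_
    ; Poss  = λ (A , xs) s → ⟦ poss D A ⟧ (λ F ys → holdsAfter F ys s) xs []ᵥ
    ; _⊏_   = _<ₕ_
    ; holds = holdsAfter
    }

  history-induction : ∀ (P : List (Action L) → Set) → P [] →
                      (∀ a s → P s → P (a ∷ s)) → ∀ s → P s
  history-induction P base step []      = base
  history-induction P base step (a ∷ s) = step a s (history-induction P base step s)

  isModel : ModelInit D structure → Model D structure
  isModel init =
    init ,
    ((λ { _ _ _ _ refl → refl , refl }) , history-induction , (λ _ ()) , (λ _ _ _ → ⇔.refl)) ,
    (λ _ _ _ → ⇔.refl) ,
    (λ _ _ _ _ → ⇔.refl)

treeModel : ∀ {L} → BAT L → Structure L → Structure L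
treeModel D M = TreeModel.structure D (state M (S0 M))

treeModel-isModel : ∀ {L} (D : BAT L) (M : Structure L) →
                    ModelInit D M → Model D (treeModel D M)
treeModel-isModel D M = TreeModel.isModel D (state M (S0 M))

module _ {H L} {Dl : BAT L} (m : RefMap H Dl) {Ml : Structure L} where

  MBisimilar⇒MIso-S0 : ∀ {Mh} → MBisimilar m Mh Ml → MIso m Mh Ml (S0 Mh) (S0 Ml)
  MBisimilar⇒MIso-S0 (B , isB , b₀) = proj₁ (isB _ _ b₀)

  module _ {Dh : BAT H} {Mh Mh′ : Structure H}
           (ap : ModelPoss Dh Mh) (ss : ModelSSA Dh Mh)
           (ap′ : ModelPoss Dh Mh′) (ss′ : ModelSSA Dh Mh′) where

    sameState∘ : (Sit Mh′ → Sit Ml → Set) → Sit Mh → Sit Ml → Set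
    sameState∘ B sh sl = Σ[ sh′ ∈ Sit Mh′ ] state Mh sh ≈[ H ] state Mh′ sh′ × B sh′ sl

    IsMBisim-sameState∘ : ∀ {B} → IsMBisim m Mh′ Ml B → IsMBisim m Mh Ml (sameState∘ B)
    IsMBisim-sameState∘ {B} isB sh sl (sh′ , e , b) with isB sh′ sl b
    ... | iso , forth , back = ≈-trans {H} e iso , forth′ , back′
      where
      Poss⇔ : ∀ a → Poss Mh a sh ⇔ Poss Mh′ a sh′
      Poss⇔ = Poss-resp-≈ {D = Dh} {Mh} {Mh′} ap ap′ e

      doₛ≈ : ∀ a → state Mh (doₛ Mh a sh) ≈[ H ] state Mh′ (doₛ Mh′ a sh′)
      doₛ≈ = doₛ-resp-≈ {D = Dh} {Mh} {Mh′} ss ss′ e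

      forth′ : ∀ A xs sh₁ → Poss Mh (A , xs) sh × sh₁ ≡ doₛ Mh (A , xs) sh →
               Σ[ sl₁ ∈ Sit Ml ] Do Ml (inst (mAct m A) xs) sl sl₁ × sameState∘ B sh₁ sl₁
      forth′ A xs _ (p , refl) with forth A xs _ (to (Poss⇔ _) p , refl)
      ... | sl₁ , run , b₁ = sl₁ , run , _ , doₛ≈ _ , b₁

      back′ : ∀ A xs sl₁ → Do Ml (inst (mAct m A) xs) sl sl₁ →
              Σ[ sh₁ ∈ Sit Mh ] (Poss Mh (A , xs) sh × sh₁ ≡ doₛ Mh (A , xs) sh)
                               × sameState∘ B sh₁ sl₁
      back′ A xs sl₁ run with back A xs sl₁ run
      ... | _ , (p , refl) , b₁ = _ , (from (Poss⇔ _) p , refl) , _ , doₛ≈ _ , b₁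

    MBisimilar-resp-≈-S0 : state Mh (S0 Mh) ≈[ H ] state Mh′ (S0 Mh′) →
                           MBisimilar m Mh′ Ml → MBisimilar m Mh Ml
    MBisimilar-resp-≈-S0 e (B , isB , b₀) = sameState∘ B , IsMBisim-sameState∘ isB , (_ , e , b₀)

InitialStatesRealizable : ∀ {H L} (Dh : BAT H) (Dl : BAT L) → RefMap H Dl → Set₁
InitialStatesRealizable {H} {L} Dh Dl m = ∀ (Mh : Structure H) → ModelInit Dh Mh →
  Σ[ Ml ∈ Structure L ] ModelInit Dl Ml × MIso m Mh Ml (S0 Mh) (S0 Ml)

theorem6 : ∀ {H L : Sig} (Dh : BAT H) (Dl : BAT L) (m : RefMap H Dl) →
    SoundAbstraction Dh Dl m →
    (CompleteAbstraction Dh Dl m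
      ⇔ (∀ (Mh : Structure H) → ModelInit Dh Mh →
           Σ[ Ml ∈ Structure L ] ModelInit Dl Ml × MIso m Mh Ml (S0 Mh) (S0 Ml)))
theorem6 {H} Dh Dl m sound = mk⇔ complete⇒initial initial⇒complete
  where
  complete⇒initial : CompleteAbstraction Dh Dl m → InitialStatesRealizable Dh Dl m
  complete⇒initial complete Mh init =
    let (Ml , (initₗ , _) , bisim) = complete _ (treeModel-isModel Dh Mh init)
    in Ml , initₗ , MBisimilar⇒MIso-S0 m {Mh = treeModel Dh Mh} bisim

  initial⇒complete : InitialStatesRealizable Dh Dl m → CompleteAbstraction Dh Dl m
  initial⇒complete initial Mh (init , _ , ap , ss) =
    let (Ml₀ , initₗ , iso₀) = initial Mh init
        (Mh′ , (_ , _ , ap′ , ss′) , bisim) = sound _ (treeModel-isModel Dl Ml₀ initₗ)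
        S0≈ = ≈-trans {H} iso₀ (≈-sym {H} (MBisimilar⇒MIso-S0 m {Mh = Mh′} bisim))
    in treeModel Dl Ml₀ , treeModel-isModel Dl Ml₀ initₗ ,
       MBisimilar-resp-≈-S0 m {Dh = Dh} {Mh} {Mh′} ap ss ap′ ss′ S0≈ bisim
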